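{- Let $n,m,Q$ be integers with $n,m\ge1$, $m$ odd, and $Q\ge2n+4m$. Let $\phi:[n,Q-n]\to\{ -1,1\}$ satisfy, for all $a,b\in[n,Q-n]$: (A1) $\phi(a)\le\phi(a+m)$ whenever $a\in[n,Q-n-m]$; (A2) if $a+b=Q$, then at least one of $a,b$ has color $-1$; (A3) if $a+b=Q+m$, then at least one of $a,b$ has color $+1$. Then every integer in $[Q+m+1,2Q-2n-2m]$ can be written as $a+b$ with $a,b\in[n,Q-n]$ (not necessarily distinct) both of color $+1$, and every integer in $[2n+2m,Q-1]$ can be written as $a+b$ with $a,b\in[n,Q-n]$ both of color $-1$.
   Context: $[a,b]$ denotes $\{a,a+1,\dots,b\}$. -}

module Defs where

open import Data.Integer using (ℤ; _≤_; _+_; _-_)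
open import Data.Sign using (Sign)
open import Data.Product using (_×_)

-- The colors -1 and +1 are represented by Sign.- and Sign.+ .
-- Order on colors inherited from -1 < +1.
data _≤ₛ_ : Sign → Sign → Set where
  refl≤ : ∀ {s} → s ≤ₛ s
  -≤+   : Sign.- ≤ₛ Sign.+

_∈[_,_] : ℤ → ℤ → ℤ → Set
a ∈[ lo , hi ] = (lo ≤ a) × (a ≤ hi)

module Submission where

-- Shift [n, Q − n] to [0, K] with K = Q − 2n.  As m is odd, K or K + m is even, and (A2), (A3)
-- at the midpoint give a v ∈ [m, K − 2m] of colour −1 with v + m of colour +1.  If s = K − t,
-- 1 ≤ t ≤ m, were not a sum of two −1 points, (A2) would carry −1 from any y ≤ s to y + t and
-- (A1) would carry it down by m, so −1 would spread from v along v + (j t mod m) up to v + m.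
-- Likewise a missing +1 sum K + m + u, 1 ≤ u ≤ m, would let +1 spread from v + m down to v.
-- Then (A1) moves −1 sums down and +1 sums up in steps of m, covering [m, K) and (K + m, 2K − m].

module Naturals where

  open import Data.Nat
  open import Data.Nat.Properties
  open import Data.Nat.DivMod
  open import Data.Nat.Divisibility using (_∣_; divides)
  open import Data.Nat.Tactic.RingSolver using (solve; solve-∀)
  open import Data.List using (_∷_; [])
  open import Data.Product using (∃; ∃₂; _×_; _,_; proj₁; proj₂)
  open import Data.Sum using (_⊎_; inj₁; inj₂; reduce; swap)
  open import Data.Sign using (Sign)
  open import Data.Sign.Properties using () renaming (_≟_ to _≟ˢ_)
  open import Relation.Nullary using (¬_; Dec; yes; no)
  open import Relation.Nullary.Decidable using (map′; _×-dec_)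
  open import Relation.Nullary.Negation using (contradiction)
  open import Relation.Binary.PropositionalEquality
  open import Defs using (_≤ₛ_; refl≤)

  ⊎-resolveʳ : ∀ {A B : Set} → A ⊎ B → ¬ A → B
  ⊎-resolveʳ (inj₁ a) ¬a = contradiction a ¬a
  ⊎-resolveʳ (inj₂ b) _  = b

  ≡-⇒≢+ : ∀ {σ} → σ ≡ Sign.- → σ ≢ Sign.+
  ≡-⇒≢+ refl ()

  ≡+⇒≢- : ∀ {σ} → σ ≡ Sign.+ → σ ≢ Sign.-
  ≡+⇒≢- refl ()

  σ≤ₛ-⇒σ≡- : ∀ {σ} → σ ≤ₛ Sign.- → σ ≡ Sign.-
  σ≤ₛ-⇒σ≡- refl≤ = refl

  +≤ₛσ⇒σ≡+ : ∀ {σ} → Sign.+ ≤ₛ σ → σ ≡ Sign.+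
  +≤ₛσ⇒σ≡+ refl≤ = refl

  even-or-odd : ∀ n → ∃ λ h → n ≡ h + h ⊎ n ≡ suc (h + h)
  even-or-odd zero = 0 , inj₁ refl
  even-or-odd (suc n) with even-or-odd n
  ... | h , inj₁ refl = h , inj₂ refl
  ... | h , inj₂ refl = suc h , inj₁ (cong suc (sym (+-suc h h)))

  m+m≤n+n⇒m≤n : ∀ {m n} → m + m ≤ n + n → m ≤ n
  m+m≤n+n⇒m≤n m+m≤n+n = ≮⇒≥ λ n<m → <⇒≱ (+-mono-< n<m n<m) m+m≤n+n

  odd-halving : ∀ {M K} → ¬ 2 ∣ M → M ≤ K → ∃ λ v → K ≡ v + v ⊎ K ≡ v + v + M
  odd-halving {M} {K} 2∤M M≤K with even-or-odd K | even-or-odd M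
  ... | h , inj₁ K≡h+h | _ = h , inj₁ K≡h+h
  ... | _ , inj₂ _ | m , inj₁ M≡m+m =
    contradiction (divides m (trans M≡m+m (+-*-two m))) 2∤M
    where
    +-*-two : ∀ m → m + m ≡ m * 2
    +-*-two = solve-∀
  ... | h , inj₂ refl | m , inj₂ refl with m≤n⇒∃[o]m+o≡n {m} {h} (m+m≤n+n⇒m≤n (s≤s⁻¹ M≤K))
  ...   | v , refl = v , inj₂ (solve (m ∷ v ∷ []))

  midpoint-bounds : ∀ {M K v} → K ≡ v + v ⊎ K ≡ v + v + M → 4 * M ≤ K → M ≤ v × v + M + M ≤ K
  midpoint-bounds {M} {_} {v} (inj₁ refl) 4M≤K = ≤-trans (m≤m+n M M) M+M≤v , v+M+M≤v+v
    where
    M+M≤v : M + M ≤ v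
    M+M≤v = m+m≤n+n⇒m≤n (subst (_≤ v + v) 4M≡ 4M≤K)
      where
      4M≡ : 4 * M ≡ M + M + (M + M)
      4M≡ = solve (M ∷ [])
    v+M+M≤v+v : v + M + M ≤ v + v
    v+M+M≤v+v = subst (_≤ v + v) (sym (+-assoc v M M)) (+-monoʳ-≤ v M+M≤v)
  midpoint-bounds {M} {_} {v} (inj₂ refl) 4M≤K = M≤v , +-monoˡ-≤ M (+-monoʳ-≤ v M≤v)
    where
    M≤v : M ≤ v
    M≤v = m+m≤n+n⇒m≤n (≤-trans (m≤m+n (M + M) M)
            (+-cancelʳ-≤ M (M + M + M) (v + v) (subst (_≤ v + v + M) 4M≡ 4M≤K)))
      where
      4M≡ : 4 * M ≡ M + M + M + M
      4M≡ = solve (M ∷ [])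

  odd-midpoint : ∀ {M K} → ¬ 2 ∣ M → 4 * M ≤ K →
    ∃ λ v → M ≤ v × v + M + M ≤ K × (K ≡ v + v ⊎ K ≡ v + v + M)
  odd-midpoint {M} {K} 2∤M 4M≤K with odd-halving 2∤M (≤-trans (m≤n*m M 4) 4M≤K)
  ... | v , K≡ = v , proj₁ bounds , proj₂ bounds , K≡
    where
    bounds : M ≤ v × v + M + M ≤ K
    bounds = midpoint-bounds K≡ 4M≤K

  [m%n+k]%n≡[m+k]%n : ∀ m k n .{{_ : NonZero n}} → (m % n + k) % n ≡ (m + k) % n
  [m%n+k]%n≡[m+k]%n m k n = begin
    (m % n + k) % n         ≡⟨ %-distribˡ-+ (m % n) k n ⟩
    (m % n % n + k % n) % n ≡⟨ cong (λ x → (x + k % n) % n) (m%n%n≡m%n m n) ⟩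
    (m % n + k % n) % n     ≡⟨ %-distribˡ-+ m k n ⟨
    (m + k) % n             ∎
    where open ≡-Reasoning

  pred[n]*m%n≡n∸m : ∀ {m n} .{{_ : NonZero n}} → 1 ≤ m → m ≤ n → pred n * m % n ≡ n ∸ m
  pred[n]*m%n≡n∸m {suc m} (s≤s z≤n) (s≤s m≤n) with m≤n⇒∃[o]m+o≡n m≤n
  ... | d , refl = begin
    (m + d) * suc m % suc (m + d)       ≡⟨ cong (_% suc (m + d)) (expand m d) ⟩
    (d + m * suc (m + d)) % suc (m + d) ≡⟨ [m+kn]%n≡m%n d m (suc (m + d)) ⟩
    d % suc (m + d)                     ≡⟨ m<n⇒m%n≡m (s≤s (m≤n+m d m)) ⟩
    d                                   ≡⟨ m+n∸m≡n m d ⟨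
    m + d ∸ m                           ∎
    where
    open ≡-Reasoning
    expand : ∀ m d → (m + d) * suc m ≡ d + m * suc (m + d)
    expand = solve-∀

  -- P holds on the orbit j * t mod M of 0 under the rotation r ↦ r + t mod M,
  -- and this orbit reaches M ∸ t at j = M − 1.
  rotation-invariant : ∀ {M t} .{{_ : NonZero M}} (P : ℕ → Set) → 1 ≤ t → t ≤ M →
    (∀ {r} → r + t < M → P r → P (r + t)) →
    (∀ {r r′} → r < M → r′ < M → r + t ≡ M + r′ → P r → P r′) →
    P 0 → P (M ∸ t)
  rotation-invariant {M} {t} P 1≤t t≤M up wrap P0 =
    subst P (pred[n]*m%n≡n∸m 1≤t t≤M) (orbit (pred M))
    where
    open ≡-Reasoning
    rotate : ∀ {r} → r < M → P r → P ((r + t) % M)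
    rotate {r} r<M Pr with r + t <? M
    ... | yes r+t<M = subst P (sym (m<n⇒m%n≡m r+t<M)) (up r+t<M Pr)
    ... | no r+t≮M with m≤n⇒∃[o]m+o≡n (≮⇒≥ r+t≮M)
    ...   | r′ , M+r′≡r+t = subst P (sym [r+t]%M≡r′) (wrap r<M r′<M (sym M+r′≡r+t) Pr)
      where
      r′<M : r′ < M
      r′<M = +-cancelˡ-< M r′ M (subst (_< M + M) (sym M+r′≡r+t) (+-mono-<-≤ r<M t≤M))
      [r+t]%M≡r′ : (r + t) % M ≡ r′
      [r+t]%M≡r′ = begin
        (r + t) % M  ≡⟨ cong (_% M) (trans (sym M+r′≡r+t) (+-comm M r′)) ⟩
        (r′ + M) % M ≡⟨ [m+n]%n≡m%n r′ M ⟩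
        r′ % M       ≡⟨ m<n⇒m%n≡m r′<M ⟩
        r′           ∎
    orbit : ∀ j → P (j * t % M)
    orbit zero    = subst P (sym (m*n%n≡0 0 M)) P0
    orbit (suc j) = subst P step (rotate (m%n<n (j * t) M) (orbit j))
      where
      step : (j * t % M + t) % M ≡ suc j * t % M
      step = trans ([m%n+k]%n≡[m+k]%n (j * t) t M) (cong (_% M) (+-comm (j * t) t))

  module Colouring (M K : ℕ) .{{_ : NonZero M}} (ψ : ℕ → Sign)
    (mono : ∀ i → i + M ≤ K → ψ i ≤ₛ ψ (i + M))
    (sum-K : ∀ i j → i ≤ K → j ≤ K → i + j ≡ K → ψ i ≡ Sign.- ⊎ ψ j ≡ Sign.-)
    (sum-K+M : ∀ i j → i ≤ K → j ≤ K → i + j ≡ K + M → ψ i ≡ Sign.+ ⊎ ψ j ≡ Sign.+)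
    where

    ColouredSum : Sign → ℕ → Set
    ColouredSum σ s = ∃₂ λ i j → i ≤ K × j ≤ K × i + j ≡ s × ψ i ≡ σ × ψ j ≡ σ

    colouredSum? : ∀ σ s → Dec (ColouredSum σ s)
    colouredSum? σ s = map′ fromSplit toSplit (anyUpTo? split? (suc s))
      where
      Split : ℕ → Set
      Split i = i ≤ K × s ∸ i ≤ K × ψ i ≡ σ × ψ (s ∸ i) ≡ σ
      split? : ∀ i → Dec (Split i)
      split? i = i ≤? K ×-dec s ∸ i ≤? K ×-dec ψ i ≟ˢ σ ×-dec ψ (s ∸ i) ≟ˢ σ
      fromSplit : (∃ λ i → i < suc s × Split i) → ColouredSum σ s
      fromSplit (i , s≤s i≤s , i≤K , j≤K , ψi , ψj) = i , s ∸ i , i≤K , j≤K , m+[n∸m]≡n i≤s , ψi , ψj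
      toSplit : ColouredSum σ s → ∃ λ i → i < suc s × Split i
      toSplit (i , j , i≤K , j≤K , i+j≡s , ψi , ψj) =
        i , s≤s (subst (i ≤_) i+j≡s (m≤m+n i j)) , i≤K ,
        subst (_≤ K) j≡s∸i j≤K , ψi , subst (λ x → ψ x ≡ σ) j≡s∸i ψj
        where
        j≡s∸i : j ≡ s ∸ i
        j≡s∸i = trans (sym (m+n∸m≡n i j)) (cong (_∸ i) i+j≡s)

    swap-summands : ∀ {σ s} → ColouredSum σ s → ColouredSum σ s
    swap-summands (i , j , i≤K , j≤K , i+j≡s , ψi , ψj) = j , i , j≤K , i≤K , trans (+-comm j i) i+j≡s , ψj , ψi

    minus-descends : ∀ {z} → z + M ≤ K → ψ (z + M) ≡ Sign.- → ψ z ≡ Sign.-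
    minus-descends {z} z+M≤K ψ[z+M] = σ≤ₛ-⇒σ≡- (subst (ψ z ≤ₛ_) ψ[z+M] (mono z z+M≤K))

    plus-ascends : ∀ {z} → z + M ≤ K → ψ z ≡ Sign.+ → ψ (z + M) ≡ Sign.+
    plus-ascends {z} z+M≤K ψz = +≤ₛσ⇒σ≡+ (subst (_≤ₛ ψ (z + M)) ψz (mono z z+M≤K))

    lower-first-summand : ∀ {s i j} → M ≤ i → i ≤ K → j ≤ K → i + j ≡ s + M →
      ψ i ≡ Sign.- → ψ j ≡ Sign.- → ColouredSum Sign.- s
    lower-first-summand {s} {j = j} M≤i i≤K j≤K i+j≡s+M ψi ψj with m≤n⇒∃[o]m+o≡n M≤i
    ... | i₁ , refl = i₁ , j , ≤-trans (m≤n+m i₁ M) i≤K , j≤K , i₁+j≡s , ψi₁ , ψj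
      where
      i₁+j≡s : i₁ + j ≡ s
      i₁+j≡s = +-cancelˡ-≡ M _ _ (trans (sym (+-assoc M i₁ j)) (trans i+j≡s+M (+-comm s M)))
      ψi₁ : ψ i₁ ≡ Sign.-
      ψi₁ = minus-descends (subst (_≤ K) (+-comm M i₁) i≤K) (subst (λ x → ψ x ≡ Sign.-) (+-comm M i₁) ψi)

    minus-sum-descends : ∀ {s} → M ≤ s → ColouredSum Sign.- (s + M) → ColouredSum Sign.- s
    minus-sum-descends {s} M≤s (i , j , i≤K , j≤K , i+j≡s+M , ψi , ψj) with M ≤? i | M ≤? j
    ... | yes M≤i | _       = lower-first-summand M≤i i≤K j≤K i+j≡s+M ψi ψj
    ... | no _    | yes M≤j = swap-summands (lower-first-summand M≤j j≤K i≤K (trans (+-comm j i) i+j≡s+M) ψj ψi)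
    ... | no M≰i  | no M≰j  =
      contradiction (subst (M + M ≤_) (sym i+j≡s+M) (+-monoˡ-≤ M M≤s)) (<⇒≱ (+-mono-< (≰⇒> M≰i) (≰⇒> M≰j)))

    raise-first-summand : ∀ {s i j} → i + M ≤ K → j ≤ K → i + j ≡ s →
      ψ i ≡ Sign.+ → ψ j ≡ Sign.+ → ColouredSum Sign.+ (s + M)
    raise-first-summand {s} {i} {j} i+M≤K j≤K i+j≡s ψi ψj =
      i + M , j , i+M≤K , j≤K , trans (shuffle i M j) (cong (_+ M) i+j≡s) , plus-ascends i+M≤K ψi , ψj
      where
      shuffle : ∀ i M j → i + M + j ≡ i + j + M
      shuffle = solve-∀

    plus-sum-ascends : ∀ {s} → s + M + M ≤ K + K → ColouredSum Sign.+ s → ColouredSum Sign.+ (s + M)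
    plus-sum-ascends {s} s+M+M≤K+K (i , j , i≤K , j≤K , i+j≡s , ψi , ψj) with i + M ≤? K | j + M ≤? K
    ... | yes i+M≤K | _         = raise-first-summand i+M≤K j≤K i+j≡s ψi ψj
    ... | no _      | yes j+M≤K = swap-summands (raise-first-summand j+M≤K i≤K (trans (+-comm j i) i+j≡s) ψj ψi)
    ... | no i+M≰K  | no j+M≰K  =
      contradiction s+M+M≤K+K (<⇒≱ (subst (K + K <_) i+M+[j+M]≡s+M+M (+-mono-< (≰⇒> i+M≰K) (≰⇒> j+M≰K))))
      where
      shuffle : ∀ i M j → i + M + (j + M) ≡ i + j + M + M
      shuffle = solve-∀
      i+M+[j+M]≡s+M+M : i + M + (j + M) ≡ s + M + M
      i+M+[j+M]≡s+M+M = trans (shuffle i M j) (cong (λ x → x + M + M) i+j≡s)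

    -- Without a minus sum s, the partner s ∸ y of y is a plus point, so its partner y + t for K is a minus point.
    minus-spreads : ∀ {s t y} → ¬ ColouredSum Sign.- s → s + t ≡ K → y ≤ s → ψ y ≡ Sign.- → ψ (y + t) ≡ Sign.-
    minus-spreads {s} {t} {y} ¬sum s+t≡K y≤s ψy =
      ⊎-resolveʳ (sum-K (s ∸ y) (y + t) s∸y≤K y+t≤K [s∸y]+[y+t]≡K)
                 (λ ψ[s∸y] → ¬sum (s ∸ y , y , s∸y≤K , ≤-trans y≤s s≤K , m∸n+n≡m y≤s , ψ[s∸y] , ψy))
      where
      s≤K : s ≤ K
      s≤K = subst (s ≤_) s+t≡K (m≤m+n s t)
      s∸y≤K : s ∸ y ≤ K
      s∸y≤K = ≤-trans (m∸n≤m s y) s≤K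
      y+t≤K : y + t ≤ K
      y+t≤K = subst (y + t ≤_) s+t≡K (+-monoˡ-≤ t y≤s)
      [s∸y]+[y+t]≡K : s ∸ y + (y + t) ≡ K
      [s∸y]+[y+t]≡K = trans (sym (+-assoc (s ∸ y) y t)) (trans (cong (_+ t) (m∸n+n≡m y≤s)) s+t≡K)

    -- Without that plus sum, the partner K ∸ y₁ of y + u = M + y₁ + u is a minus point,
    -- so its partner y for K + M is a plus point.
    plus-spreads-down : ∀ {u y} → ¬ ColouredSum Sign.+ (K + M + u) → M ≤ y → y + u ≤ K →
      ψ (y + u) ≡ Sign.+ → ψ y ≡ Sign.+
    plus-spreads-down {u} ¬sum M≤y y+u≤K ψ[y+u] with m≤n⇒∃[o]m+o≡n M≤y
    ... | y₁ , refl =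
      ⊎-resolveʳ (sum-K+M (K ∸ y₁) (M + y₁) (m∸n≤m K y₁) M+y₁≤K [K∸y₁]+[M+y₁]≡K+M)
                 (λ ψ[K∸y₁] → ¬sum (K ∸ y₁ , M + y₁ + u , m∸n≤m K y₁ , y+u≤K ,
                                    trans (sym (+-assoc (K ∸ y₁) (M + y₁) u)) (cong (_+ u) [K∸y₁]+[M+y₁]≡K+M) ,
                                    ψ[K∸y₁] , ψ[y+u]))
      where
      M+y₁≤K : M + y₁ ≤ K
      M+y₁≤K = ≤-trans (m≤m+n (M + y₁) u) y+u≤K
      [K∸y₁]+[M+y₁]≡K+M : K ∸ y₁ + (M + y₁) ≡ K + M
      [K∸y₁]+[M+y₁]≡K+M = begin
        K ∸ y₁ + (M + y₁)   ≡⟨ cong (K ∸ y₁ +_) (+-comm M y₁) ⟩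
        K ∸ y₁ + (y₁ + M)   ≡⟨ +-assoc (K ∸ y₁) y₁ M ⟨
        K ∸ y₁ + y₁ + M     ≡⟨ cong (_+ M) (m∸n+n≡m (≤-trans (m≤n+m y₁ M) M+y₁≤K)) ⟩
        K + M               ∎
        where open ≡-Reasoning

    midpoint-colours : ∀ {v} → v + M ≤ K → K ≡ v + v ⊎ K ≡ v + v + M → ψ v ≡ Sign.- × ψ (v + M) ≡ Sign.+
    midpoint-colours {v} v+M≤K (inj₁ K≡v+v) = ψv , ψ[v+M]
      where
      v≤K : v ≤ K
      v≤K = ≤-trans (m≤m+n v M) v+M≤K
      ψv : ψ v ≡ Sign.-
      ψv = reduce (sum-K v v v≤K v≤K (sym K≡v+v))
      ψ[v+M] : ψ (v + M) ≡ Sign.+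
      ψ[v+M] = ⊎-resolveʳ (sum-K+M v (v + M) v≤K v+M≤K (trans (sym (+-assoc v v M)) (cong (_+ M) (sym K≡v+v))))
                          (≡-⇒≢+ ψv)
    midpoint-colours {v} v+M≤K (inj₂ K≡v+v+M) = ψv , ψ[v+M]
      where
      shuffle : ∀ v M → v + M + (v + M) ≡ v + v + M + M
      shuffle = solve-∀
      ψ[v+M] : ψ (v + M) ≡ Sign.+
      ψ[v+M] = reduce (sum-K+M (v + M) (v + M) v+M≤K v+M≤K (trans (shuffle v M) (cong (_+ M) (sym K≡v+v+M))))
      ψv : ψ v ≡ Sign.-
      ψv = ⊎-resolveʳ (swap (sum-K v (v + M) (≤-trans (m≤m+n v M) v+M≤K) v+M≤K
                                   (trans (sym (+-assoc v v M)) (sym K≡v+v+M))))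
                      (≡+⇒≢- ψ[v+M])

    module _ {v} (M≤v : M ≤ v) (v+M+M≤K : v + M + M ≤ K) (ψv : ψ v ≡ Sign.-) (ψ[v+M] : ψ (v + M) ≡ Sign.+) where

      below-v+M : ∀ {w c} → c ≤ M → w + c ≡ v + M → M ≤ w × w + M ≤ K
      below-v+M {w} {c} c≤M w+c≡v+M = ≤-trans M≤v v≤w , ≤-trans (+-monoˡ-≤ M w≤v+M) v+M+M≤K
        where
        v≤w : v ≤ w
        v≤w = +-cancelʳ-≤ c v w (subst (v + c ≤_) (sym w+c≡v+M) (+-monoʳ-≤ v c≤M))
        w≤v+M : w ≤ v + M
        w≤v+M = subst (w ≤_) w+c≡v+M (m≤m+n w c)

      minus-sum-near-K : ∀ {s t} → 1 ≤ t → t ≤ M → s + t ≡ K → ColouredSum Sign.- s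
      minus-sum-near-K {s} {t} 1≤t t≤M s+t≡K with colouredSum? Sign.- s
      ... | yes sum = sum
      ... | no ¬sum = contradiction ψ[v+M]≡- (≡+⇒≢- ψ[v+M])
        where
        spread : ∀ {y} → y ≤ s → ψ y ≡ Sign.- → ψ (y + t) ≡ Sign.-
        spread = minus-spreads ¬sum s+t≡K
        v+r≤s : ∀ {r} → r ≤ M → v + r ≤ s
        v+r≤s {r} r≤M = +-cancelʳ-≤ t (v + r) s (begin
          v + r + t ≤⟨ +-mono-≤ (+-monoʳ-≤ v r≤M) t≤M ⟩
          v + M + M ≤⟨ v+M+M≤K ⟩
          K         ≡⟨ s+t≡K ⟨
          s + t     ∎)
          where open ≤-Reasoning
        -- The minus points among v + r, r < M, are closed under r ↦ r + t mod M.
        Minus : ℕ → Set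
        Minus r = ψ (v + r) ≡ Sign.-
        up : ∀ {r} → r + t < M → Minus r → Minus (r + t)
        up {r} r+t<M ψ[v+r] =
          subst (λ x → ψ x ≡ Sign.-) (+-assoc v r t) (spread (v+r≤s (≤-trans (m≤m+n r t) (<⇒≤ r+t<M))) ψ[v+r])
        wrap : ∀ {r r′} → r < M → r′ < M → r + t ≡ M + r′ → Minus r → Minus r′
        wrap {r} {r′} r<M r′<M r+t≡M+r′ ψ[v+r] =
          minus-descends v+r′+M≤K (subst (λ x → ψ x ≡ Sign.-) v+r+t≡v+r′+M (spread (v+r≤s (<⇒≤ r<M)) ψ[v+r]))
          where
          v+r′+M≤K : v + r′ + M ≤ K
          v+r′+M≤K = ≤-trans (+-monoˡ-≤ M (+-monoʳ-≤ v (<⇒≤ r′<M))) v+M+M≤K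
          shuffle : ∀ v M r′ → v + (M + r′) ≡ v + r′ + M
          shuffle = solve-∀
          v+r+t≡v+r′+M : v + r + t ≡ v + r′ + M
          v+r+t≡v+r′+M = trans (+-assoc v r t) (trans (cong (v +_) r+t≡M+r′) (shuffle v M r′))
        ψ[v+M]≡- : ψ (v + M) ≡ Sign.-
        ψ[v+M]≡- = subst (λ x → ψ x ≡ Sign.-) (trans (+-assoc v (M ∸ t) t) (cong (v +_) (m∸n+n≡m t≤M)))
          (spread (v+r≤s (m∸n≤m M t))
            (rotation-invariant Minus 1≤t t≤M up wrap (subst (λ x → ψ x ≡ Sign.-) (sym (+-identityʳ v)) ψv)))

      plus-sum-above-K+M : ∀ {u} → 1 ≤ u → u ≤ M → ColouredSum Sign.+ (K + M + u)
      plus-sum-above-K+M {u} 1≤u u≤M with colouredSum? Sign.+ (K + M + u)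
      ... | yes sum = sum
      ... | no ¬sum = contradiction ψv≡+ (≡-⇒≢+ ψv)
        where
        spread-from : ∀ {w c} → c ≤ M → w + c ≡ v + M → ψ (w + u) ≡ Sign.+ → ψ w ≡ Sign.+
        spread-from c≤M w+c≡v+M with below-v+M c≤M w+c≡v+M
        ... | M≤w , w+M≤K = plus-spreads-down ¬sum M≤w (≤-trans (+-monoʳ-≤ _ u≤M) w+M≤K)
        shuffle : ∀ w u c → w + u + c ≡ w + (c + u)
        shuffle = solve-∀
        -- Plus c says that v + M − c is a plus point; this is closed under c ↦ c + u mod M.
        Plus : ℕ → Set
        Plus c = ∀ {w} → w + c ≡ v + M → ψ w ≡ Sign.+
        start : Plus 0
        start {w} w+0≡v+M = subst (λ x → ψ x ≡ Sign.+) (trans (sym w+0≡v+M) (+-identityʳ w)) ψ[v+M]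
        up : ∀ {c} → c + u < M → Plus c → Plus (c + u)
        up {c} c+u<M plus {w} w+[c+u]≡v+M =
          spread-from (<⇒≤ c+u<M) w+[c+u]≡v+M (plus (trans (shuffle w u c) w+[c+u]≡v+M))
        wrap : ∀ {c c′} → c < M → c′ < M → c + u ≡ M + c′ → Plus c → Plus c′
        wrap {c} {c′} _ c′<M c+u≡M+c′ plus {w} w+c′≡v+M with below-v+M (<⇒≤ c′<M) w+c′≡v+M
        ... | M≤w , w+M≤K with m≤n⇒∃[o]m+o≡n M≤w
        ...   | w₁ , refl = spread-from (<⇒≤ c′<M) w+c′≡v+M
                            (subst (λ x → ψ x ≡ Sign.+) (shuffle₂ w₁ u M) (plus-ascends w₁+u+M≤K ψ[w₁+u]))
          where
          shuffle₁ : ∀ w₁ M c′ → w₁ + (M + c′) ≡ M + w₁ + c′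
          shuffle₁ = solve-∀
          shuffle₂ : ∀ w₁ u M → w₁ + u + M ≡ M + w₁ + u
          shuffle₂ = solve-∀
          ψ[w₁+u] : ψ (w₁ + u) ≡ Sign.+
          ψ[w₁+u] = plus (trans (shuffle w₁ u c)
                                (trans (cong (w₁ +_) c+u≡M+c′) (trans (shuffle₁ w₁ M c′) w+c′≡v+M)))
          w₁+u+M≤K : w₁ + u + M ≤ K
          w₁+u+M≤K = subst (_≤ K) (sym (shuffle₂ w₁ u M)) (≤-trans (+-monoʳ-≤ (M + w₁) u≤M) w+M≤K)
        ψv≡+ : ψ v ≡ Sign.+
        ψv≡+ = spread-from ≤-refl refl
          (rotation-invariant Plus 1≤u u≤M up wrap start (trans (+-assoc v u (M ∸ u)) (cong (v +_) (m+[n∸m]≡n u≤M))))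

      minus-sum-ladder : ∀ k {s t} → 1 ≤ t → t ≤ M → M ≤ s → s + (t + k * M) ≡ K → ColouredSum Sign.- s
      minus-sum-ladder zero    {s} {t} 1≤t t≤M _   e = minus-sum-near-K 1≤t t≤M (trans (cong (s +_) (sym (+-identityʳ t))) e)
      minus-sum-ladder (suc k) {s} {t} 1≤t t≤M M≤s e =
        minus-sum-descends M≤s (minus-sum-ladder k 1≤t t≤M (≤-trans M≤s (m≤m+n s M)) (trans (shuffle s M t k) e))
        where
        shuffle : ∀ s M t k → s + M + (t + k * M) ≡ s + (t + suc k * M)
        shuffle = solve-∀

      plus-sum-ladder : ∀ k {u} → 1 ≤ u → u ≤ M → K + M + (u + k * M) + M ≤ K + K →
        ColouredSum Sign.+ (K + M + (u + k * M))
      plus-sum-ladder zero    {u} 1≤u u≤M _ =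
        subst (ColouredSum Sign.+) (cong (K + M +_) (sym (+-identityʳ u))) (plus-sum-above-K+M 1≤u u≤M)
      plus-sum-ladder (suc k) {u} 1≤u u≤M bound =
        subst (ColouredSum Sign.+) (shuffle K M u k)
          (plus-sum-ascends bound′ (plus-sum-ladder k 1≤u u≤M (≤-trans (m≤m+n _ M) bound′)))
        where
        shuffle : ∀ K M u k → K + M + (u + k * M) + M ≡ K + M + (u + suc k * M)
        shuffle = solve-∀
        bound′ : K + M + (u + k * M) + M + M ≤ K + K
        bound′ = subst (λ x → x + M ≤ K + K) (sym (shuffle K M u k)) bound

      minus-sums : ∀ {s} → M ≤ s → s < K → ColouredSum Sign.- s
      minus-sums {s} M≤s s<K with m≤n⇒∃[o]m+o≡n s<K
      ... | d , 1+s+d≡K = minus-sum-ladder (d / M) (s≤s z≤n) (m%n<n d M) M≤s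
        (trans (cong (λ x → s + suc x) (sym (m≡m%n+[m/n]*n d M))) (trans (+-suc s d) 1+s+d≡K))

      plus-sums : ∀ {s} → K + M < s → s + M ≤ K + K → ColouredSum Sign.+ s
      plus-sums {s} K+M<s s+M≤K+K with m≤n⇒∃[o]m+o≡n K+M<s
      ... | d , 1+K+M+d≡s = subst (ColouredSum Sign.+) s≡ (plus-sum-ladder (d / M) (s≤s z≤n) (m%n<n d M)
                                                            (subst (λ x → x + M ≤ K + K) (sym s≡) s+M≤K+K))
        where
        s≡ : K + M + (suc (d % M) + d / M * M) ≡ s
        s≡ = trans (cong (λ x → K + M + suc x) (sym (m≡m%n+[m/n]*n d M))) (trans (+-suc (K + M) d) 1+K+M+d≡s)

    monochromatic-sums : ¬ 2 ∣ M → 4 * M ≤ K →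
      (∀ {s} → K + M < s → s + M ≤ K + K → ColouredSum Sign.+ s) ×
      (∀ {s} → M ≤ s → s < K → ColouredSum Sign.- s)
    monochromatic-sums 2∤M 4M≤K with odd-midpoint 2∤M 4M≤K
    ... | v , M≤v , v+M+M≤K , K≡ =
      plus-sums M≤v v+M+M≤K (proj₁ colours) (proj₂ colours) , minus-sums M≤v v+M+M≤K (proj₁ colours) (proj₂ colours)
      where
      colours : ψ v ≡ Sign.- × ψ (v + M) ≡ Sign.+
      colours = midpoint-colours (≤-trans (m≤m+n (v + M) M) v+M+M≤K) K≡

open import Defs
open import Data.Integer using (ℤ; _≤_; _+_; _-_; _*_; +_; 1ℤ)
open import Data.Integer.Divisibility using (_∣_)
open import Relation.Nullary using (¬_)
open import Data.Sign using (Sign)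
open import Data.Product using (_×_; ∃₂)
open import Data.Sum using (_⊎_)
open import Relation.Binary.PropositionalEquality using (_≡_)

open import Data.Integer using (-[1+_]; -_; +≤+; ∣_∣)
open import Data.Integer.Properties
  using (+-monoʳ-≤; +-monoˡ-≤; i≤i+j; i≤j⇒0≤j-i; 0≤i⇒+∣i∣≡i; drop‿+≤+; pos-+; pos-*; +-assoc;
         module ≤-Reasoning)
open import Data.Integer.Tactic.RingSolver using (solve-∀)
import Data.Nat as ℕ
import Data.Nat.Properties as ℕ
open import Data.Product using (∃; _,_; proj₁; proj₂)
open import Relation.Binary.PropositionalEquality using (refl; sym; trans; cong; subst; subst₂)
open Naturals using (module Colouring)

≤-offset : ∀ {x y} → x ≤ y → ∃ λ k → y ≡ x + + k
≤-offset {x} {y} x≤y = ∣ y - x ∣ , trans (y≡x+[y-x] x y) (cong (_+_ x) (sym (0≤i⇒+∣i∣≡i (i≤j⇒0≤j-i x≤y))))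
  where
  y≡x+[y-x] : ∀ x y → y ≡ x + (y - x)
  y≡x+[y-x] = solve-∀

[i+m]+n≡i+[m+n] : ∀ i m n → i + + m + + n ≡ i + + (m ℕ.+ n)
[i+m]+n≡i+[m+n] i m n = trans (+-assoc i (+ m) (+ n)) (cong (_+_ i) (sym (pos-+ m n)))

i+m≤i+n⇒m≤n : ∀ i {m n} → i + + m ≤ i + + n → m ℕ.≤ n
i+m≤i+n⇒m≤n i {m} {n} i+m≤i+n =
  drop‿+≤+ (subst₂ _≤_ (cancel i (+ m)) (cancel i (+ n)) (+-monoʳ-≤ (- i) i+m≤i+n))
  where
  cancel : ∀ i j → - i + (i + j) ≡ j
  cancel = solve-∀

i+j≤k⇒i≤k-j : ∀ {i j k} → i + j ≤ k → i ≤ k - j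
i+j≤k⇒i≤k-j {i} {j} {k} i+j≤k = subst (_≤ k - j) (cancel i j) (+-monoˡ-≤ (- j) i+j≤k)
  where
  cancel : ∀ i j → i + j - j ≡ i
  cancel = solve-∀

≤-offset-from : ∀ i {m y} → i + + m ≤ y → ∃ λ k → y ≡ i + + (m ℕ.+ k)
≤-offset-from i {m} i+m≤y with ≤-offset i+m≤y
... | k , refl = k , [i+m]+n≡i+[m+n] i m k

-- d lets the upper end H = c + hi − d be described without truncated subtraction.
∈-offset : ∀ c {lo hi d L H S} → L ≡ c + + lo → H + + d ≡ c + + hi → S ∈[ L , H ] →
  ∃ λ s → S ≡ c + + s × lo ℕ.≤ s × s ℕ.+ d ℕ.≤ hi
∈-offset c {lo} {hi} {d} {H = H} refl H+d≡c+hi (L≤S , S≤H) with ≤-offset-from c L≤S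
... | k , refl = lo ℕ.+ k , refl , ℕ.m≤m+n lo k , i+m≤i+n⇒m≤n c (begin
  c + + (lo ℕ.+ k ℕ.+ d)   ≡⟨ [i+m]+n≡i+[m+n] c (lo ℕ.+ k) d ⟨
  c + + (lo ℕ.+ k) + + d   ≤⟨ +-monoˡ-≤ (+ d) S≤H ⟩
  H + + d                  ≡⟨ H+d≡c+hi ⟩
  c + + hi                 ∎)
  where open ≤-Reasoning

2n+4m≡n+n+4m : ∀ n M → + 2 * n + + 4 * + M ≡ n + n + + (4 ℕ.* M)
2n+4m≡n+n+4m n M = trans (ring n (+ M)) (cong (_+_ (n + n)) (sym (pos-* 4 M)))
  where
  ring : ∀ n m → + 2 * n + + 4 * m ≡ n + n + + 4 * m
  ring = solve-∀

-- [n, Q − n] with Q = 2n + K, as the shift of [0, K] by n.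
module Shift (n : ℤ) (K : ℕ.ℕ) where

  shift-∈ : ∀ {i} → i ℕ.≤ K → (n + + i) ∈[ n , n + n + + K - n ]
  shift-∈ {i} i≤K = i≤i+j n (+ i) , subst (n + + i ≤_) (ring n (+ K)) (+-monoʳ-≤ n (+≤+ i≤K))
    where
    ring : ∀ n k → n + k ≡ n + n + k - n
    ring = solve-∀

  shift-∈-shortened : ∀ {i M} → i ℕ.+ M ℕ.≤ K → (n + + i) ∈[ n , n + n + + K - n - + M ]
  shift-∈-shortened {i} {M} i+M≤K =
    i≤i+j n (+ i) , i+j≤k⇒i≤k-j (subst (_≤ n + n + + K - n) (sym ([i+m]+n≡i+[m+n] n i M)) (proj₂ (shift-∈ i+M≤K)))

  shift-+ : ∀ {i j s} → i ℕ.+ j ≡ s → n + + i + (n + + j) ≡ n + n + + s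
  shift-+ {i} {j} refl = trans (ring n (+ i) (+ j)) (cong (_+_ (n + n)) (sym (pos-+ i j)))
    where
    ring : ∀ n i j → n + i + (n + j) ≡ n + n + (i + j)
    ring = solve-∀

  upper-range : ∀ {M S} → S ∈[ n + n + + K + + M + 1ℤ , + 2 * (n + n + + K) - + 2 * n - + 2 * + M ] →
    ∃ λ s → S ≡ n + n + + s × K ℕ.+ M ℕ.< s × s ℕ.+ M ℕ.≤ K ℕ.+ K
  upper-range {M} S∈ with ∈-offset (n + n) L≡ H+M+M≡ S∈
    where
    L≡ : n + n + + K + + M + 1ℤ ≡ n + n + + ℕ.suc (K ℕ.+ M)
    L≡ = trans (ring (n + n) (+ K) (+ M))
               (cong (_+_ (n + n)) (sym (trans (pos-+ 1 (K ℕ.+ M)) (cong (_+_ 1ℤ) (pos-+ K M)))))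
      where
      ring : ∀ c k m → c + k + m + 1ℤ ≡ c + (1ℤ + (k + m))
      ring = solve-∀
    H+M+M≡ : + 2 * (n + n + + K) - + 2 * n - + 2 * + M + + (M ℕ.+ M) ≡ n + n + + (K ℕ.+ K)
    H+M+M≡ = trans (cong (_+_ (+ 2 * (n + n + + K) - + 2 * n - + 2 * + M)) (pos-+ M M))
                   (trans (ring n (+ K) (+ M)) (cong (_+_ (n + n)) (sym (pos-+ K K))))
      where
      ring : ∀ n k m → + 2 * (n + n + k) - + 2 * n - + 2 * m + (m + m) ≡ n + n + (k + k)
      ring = solve-∀
  ... | s , S≡ , K+M<s , s+M+M≤K+K = s , S≡ , K+M<s , ℕ.≤-trans (ℕ.+-monoʳ-≤ s (ℕ.m≤m+n M M)) s+M+M≤K+K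

  lower-range : ∀ {M S} → S ∈[ + 2 * n + + 2 * + M , n + n + + K - 1ℤ ] →
    ∃ λ s → S ≡ n + n + + s × M ℕ.≤ s × s ℕ.< K
  lower-range {M} S∈ with ∈-offset (n + n) L≡ H+1≡ S∈
    where
    L≡ : + 2 * n + + 2 * + M ≡ n + n + + (M ℕ.+ M)
    L≡ = trans (ring n (+ M)) (cong (_+_ (n + n)) (sym (pos-+ M M)))
      where
      ring : ∀ n m → + 2 * n + + 2 * m ≡ n + n + (m + m)
      ring = solve-∀
    H+1≡ : n + n + + K - 1ℤ + + 1 ≡ n + n + + K
    H+1≡ = ring (n + n) (+ K)
      where
      ring : ∀ c k → c + k - 1ℤ + + 1 ≡ c + k
      ring = solve-∀
  ... | s , S≡ , M+M≤s , s+1≤K = s , S≡ , ℕ.≤-trans (ℕ.m≤m+n M M) M+M≤s , subst (ℕ._≤ K) (ℕ.+-comm s 1) s+1≤K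

  module _ (φ : ℤ → Sign) where

    shift-sum : ∀ {σ s S} → S ≡ n + n + + s →
      (∃₂ λ i j → i ℕ.≤ K × j ℕ.≤ K × i ℕ.+ j ≡ s × φ (n + + i) ≡ σ × φ (n + + j) ≡ σ) →
      ∃₂ λ a b → a ∈[ n , n + n + + K - n ] × b ∈[ n , n + n + + K - n ] × a + b ≡ S × φ a ≡ σ × φ b ≡ σ
    shift-sum refl (i , j , i≤K , j≤K , i+j≡s , φi , φj) =
      n + + i , n + + j , shift-∈ i≤K , shift-∈ j≤K , shift-+ i+j≡s , φi , φj

proposition2p6 : (n m Q : ℤ) → 1ℤ ≤ n → 1ℤ ≤ m → ¬ (+ 2 ∣ m) → (+ 2 * n) + (+ 4 * m) ≤ Q →
    (φ : ℤ → Sign) →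
    (∀ a → a ∈[ n , Q - n - m ] → φ a ≤ₛ φ (a + m)) →
    (∀ a b → a ∈[ n , Q - n ] → b ∈[ n , Q - n ] → a + b ≡ Q → (φ a ≡ Sign.- ⊎ φ b ≡ Sign.-)) →
    (∀ a b → a ∈[ n , Q - n ] → b ∈[ n , Q - n ] → a + b ≡ Q + m → (φ a ≡ Sign.+ ⊎ φ b ≡ Sign.+)) →
    (∀ s → s ∈[ Q + m + 1ℤ , (+ 2 * Q) - (+ 2 * n) - (+ 2 * m) ] →
      ∃₂ λ a b → a ∈[ n , Q - n ] × b ∈[ n , Q - n ] × a + b ≡ s × φ a ≡ Sign.+ × φ b ≡ Sign.+)
    × (∀ s → s ∈[ (+ 2 * n) + (+ 2 * m) , Q - 1ℤ ] →
      ∃₂ λ a b → a ∈[ n , Q - n ] × b ∈[ n , Q - n ] × a + b ≡ s × φ a ≡ Sign.- × φ b ≡ Sign.-)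
proposition2p6 n -[1+ _ ] Q _ () _ _ _ _ _ _
proposition2p6 n (+ M) Q _ (+≤+ 1≤M) 2∤M 2n+4M≤Q φ mono sum-Q sum-Q+M
  with ≤-offset-from (n + n) (subst (_≤ Q) (2n+4m≡n+n+4m n M) 2n+4M≤Q)
... | e , refl =
  (λ S S∈ → let s , S≡ , K+M<s , s+M≤K+K = upper-range S∈ in
    shift-sum φ S≡ (proj₁ (monochromatic-sums 2∤M 4M≤K) K+M<s s+M≤K+K)) ,
  (λ S S∈ → let s , S≡ , M≤s , s<K = lower-range S∈ in
    shift-sum φ S≡ (proj₂ (monochromatic-sums 2∤M 4M≤K) M≤s s<K))
  where
  K : ℕ.ℕ
  K = 4 ℕ.* M ℕ.+ e
  4M≤K : 4 ℕ.* M ℕ.≤ K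
  4M≤K = ℕ.m≤m+n (4 ℕ.* M) e
  open Shift n K
  open Colouring M K {{ℕ.>-nonZero 1≤M}} (λ i → φ (n + + i))
    (λ i i+M≤K → subst (λ a → φ (n + + i) ≤ₛ φ a) ([i+m]+n≡i+[m+n] n i M)
                   (mono (n + + i) (shift-∈-shortened i+M≤K)))
    (λ i j i≤K j≤K i+j≡K → sum-Q (n + + i) (n + + j) (shift-∈ i≤K) (shift-∈ j≤K) (shift-+ i+j≡K))
    (λ i j i≤K j≤K i+j≡K+M → sum-Q+M (n + + i) (n + + j) (shift-∈ i≤K) (shift-∈ j≤K)
                               (trans (shift-+ i+j≡K+M) (sym ([i+m]+n≡i+[m+n] (n + n) K M))))
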